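{- Let $r$ be a positive integer, $k\in\mathbb Z$, and $a_1,\dots,a_r$ nonzero complex numbers. Then for every integer $n\ge0$, $$S_n^{(r,k)}(x|a_1,\dots,a_r)=\sum_{m=0}^n\left(\sum_{l=m}^nS_2(l,m)\binom{n}{l}S_{n-l}^{(r,k)}(-m|a_1,\dots,a_r)\right)(x)^{(m)},$$ where $(x)^{(m)}=x(x+1)\cdots(x+m-1)$ for $m\ge1$ and $(x)^{(0)}=1$.
   Context: For an integer $k$, ${\rm Li}_k(x)=\sum_{m=1}^\infty x^m/m^k$. For $r\in\mathbb Z_{>0}$, $k\in\mathbb Z$ and nonzero complex $a_1,\dots,a_r$, the polynomials $S_n^{(r,k)}(x|a_1,\dots,a_r)$ are defined by $\frac{t^r}{\prod_{j=1}^r(e^{a_jt}-1)}\frac{{\rm Li}_k(1-e^{ -t})}{1-e^{ -t}}e^{xt}=\sum_{n\ge0}S_n^{(r,k)}(x|a_1,\dots,a_r)\frac{t^n}{n!}$. $S_2(l,m)$ are the Stirling numbers of the second kind: $(e^t-1)^m=m!\sum_{l\ge m}S_2(l,m)\frac{t^l}{l!}$. -}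

module Defs where

open import Level using (Level; _⊔_) renaming (suc to lsuc)
open import Data.Nat using (ℕ; zero; suc; _∸_; _!) renaming (_+_ to _+ℕ_; _*_ to _*ℕ_)
open import Data.Nat.Combinatorics using (_C_)
open import Data.Integer using (ℤ; +_; -[1+_])
open import Data.Fin using (Fin)
open import Data.List using (List; []; _∷_; _++_; [_])
open import Relation.Nullary using (¬_)
open import Algebra.Bundles using (CommutativeRing)

-- These are exactly the numbers with (e^t-1)^m = m! Σ_l S2 l m t^l/l!.

S2 : ℕ → ℕ → ℕ
S2 zero    zero    = 1
S2 zero    (suc m) = 0
S2 (suc l) zero    = 0
S2 (suc l) (suc m) = suc m *ℕ S2 l (suc m) +ℕ S2 l m

module _ {c ℓ : Level} (R : CommutativeRing c ℓ) where
  open CommutativeRing R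

  ι : ℕ → Carrier
  ι zero    = 0#
  ι (suc n) = 1# + ι n

  -- A field of characteristic zero structure on R (C is an instance).
  record CharZeroField : Set (c ⊔ ℓ) where
    field
      inv         : (x : Carrier) → ¬ (x ≈ 0#) → Carrier
      inv-correct : (x : Carrier) (p : ¬ (x ≈ 0#)) → x * inv x p ≈ 1#
      char0       : (n : ℕ) → ¬ (ι (suc n) ≈ 0#)
      1≉0         : ¬ (1# ≈ 0#)

  pow : Carrier → ℕ → Carrier
  pow x zero    = 1#
  pow x (suc n) = pow x n * x

  sumTo : ℕ → (ℕ → Carrier) → Carrier
  sumTo zero    f = f 0
  sumTo (suc n) f = sumTo n f + f (suc n)

  -- Σ_{i=a}^{b} f i  (empty, i.e. 0#, when b < a)
  sumFromTo : ℕ → ℕ → (ℕ → Carrier) → Carrier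
  sumFromTo a b f = go (suc b ∸ a)
    where
    go : ℕ → Carrier
    go zero    = 0#
    go (suc k) = go k + f (a +ℕ k)

  rising : Carrier → ℕ → Carrier
  rising x zero    = 1#
  rising x (suc m) = rising x m * (x + ι m)

  -- Formal power series over R: the n-th entry is the coefficient of t^n.

  FPS : Set c
  FPS = ℕ → Carrier

  _⊛_ : FPS → FPS → FPS
  (f ⊛ g) n = sumTo n (λ i → f i * g (n ∸ i))

  oneS : FPS
  oneS zero    = 1#
  oneS (suc n) = 0#

  powS : FPS → ℕ → FPS
  powS f zero    = oneS
  powS f (suc m) = powS f m ⊛ f

  prodS : (r : ℕ) → (Fin r → FPS) → FPS
  prodS zero    F = oneS
  prodS (suc r) F = F Fin.zero ⊛ prodS r (λ j → F (Fin.suc j))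
    where import Data.Fin as Fin

  lookupD : List Carrier → ℕ → Carrier
  lookupD []       n       = 0#
  lookupD (x ∷ xs) zero    = x
  lookupD (x ∷ xs) (suc n) = lookupD xs n

  module WithField (F : CharZeroField) where
    open CharZeroField F

    invFact : ℕ → Carrier
    invFact zero    = 1#
    invFact (suc n) = invFact n * inv (ι (suc n)) (char0 n)

    -- multiplicative inverse of a formal power series f, given u = (f 0)⁻¹:
    -- g 0 = u, g n = -u Σ_{i=1}^{n} f i g (n-i)
    invS : (f : FPS) → (u : Carrier) → FPS
    invS f u n = lookupD (coeffs n) n
      where
      coeffs : ℕ → List Carrier
      coeffs zero    = [ u ]
      coeffs (suc n) = coeffs n ++
        [ - (u * sumFromTo 1 (suc n) (λ i → f i * lookupD (coeffs n) (suc n ∸ i))) ]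

    expS : Carrier → FPS
    expS x n = pow x n * invFact n

    expm1OverT : Carrier → FPS
    expm1OverT a n = pow a (suc n) * invFact (suc n)

    -- t/(e^{a t} - 1) for a ≠ 0: inverse of (e^{a t}-1)/t, whose constant term is a
    tOverExpm1 : (a : Carrier) → ¬ (a ≈ 0#) → FPS
    tOverExpm1 a p = invS (expm1OverT a) (inv a p)

    oneMinusExpNeg : FPS
    oneMinusExpNeg n = oneS n + - expS (- 1#) n

    -- 1/m^k for m = suc m' ≥ 1 and k ∈ ℤ
    invPowZ : ℕ → ℤ → Carrier
    invPowZ m' (+ j)      = pow (inv (ι (suc m')) (char0 m')) j
    invPowZ m' (-[1+ j ]) = pow (ι (suc m')) (suc j)

    -- Li_k(1 - e^{-t}) / (1 - e^{-t}) = Σ_{m≥1} (1-e^{-t})^{m-1} / m^k.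
    -- (1-e^{-t})^{m-1} has order m-1, so the coefficient of t^n only
    -- receives contributions from m-1 = m' ≤ n.
    liS : ℤ → FPS
    liS k n = sumTo n (λ m' → invPowZ m' k * powS oneMinusExpNeg m' n)

    -- S_n^{(r,k)}(x | a_1..a_r): n! times the coefficient of t^n in
    --   Π_j t/(e^{a_j t}-1) · Li_k(1-e^{-t})/(1-e^{-t}) · e^{x t}
    Spoly : (r : ℕ) (k : ℤ) (a : Fin r → Carrier) → ((j : Fin r) → ¬ (a j ≈ 0#))
          → ℕ → Carrier → Carrier
    Spoly r k a p n x =
      ι (n !) * (((prodS r (λ j → tOverExpm1 (a j) (p j))) ⊛ liS k) ⊛ expS x) n

{-# OPTIONS --safe #-}
module Submission where

-- Nothing but the factor e^{xt} matters: the identity holds with any power series g in place of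
-- the product of the t/(e^{a_j t} - 1) and Li_k(1 - e^{-t})/(1 - e^{-t}).  Since
-- n! [t^n] (g e^{xt}) = Σ_i C(n,i) i! g_i x^{n-i}, it suffices to expand powers of x in rising
-- factorials.  With B_m(N, y) = Σ_l C(N,l) S2(l,m) y^{N-l}, Pascal's rule and the Stirling
-- recurrence give B_m(N+1, y) = (y + m) B_m(N, y) + B_{m-1}(N, y), and together with
-- (x)^{(m+1)} = x (x+1)^{(m)} this yields (x + y)^N = Σ_m (x)^{(m)} B_m(N, y - m) by induction
-- on N.  Taking y = 0 and exchanging the sums over i and l by C(n,l) C(n-l,i) = C(n,i) C(n-i,l)
-- regroups the result into the stated coefficients.

open import Defs
open import Level using (Level)
open import Data.Nat using (ℕ; zero; suc; _∸_; _≤_; _<_; _≤′_; ≤′-refl; ≤′-step; _!; s≤s)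
  renaming (_+_ to _+ℕ_; _*_ to _*ℕ_)
import Data.Nat.Properties as ℕₚ
open import Data.Nat.Combinatorics using (_C_; k>n⇒nCk≡0; nCk+nC[k+1]≡[n+1]C[k+1])
open import Data.Integer using (ℤ)
open import Data.Fin using (Fin)
open import Relation.Nullary using (¬_)
open import Relation.Binary.PropositionalEquality as ≡ using (_≡_)
open import Algebra.Bundles using (CommutativeRing)
import Algebra.Properties.AbelianGroup as AbelianGroupProperties
import Algebra.Solver.Ring.NaturalCoefficients.Default as NatCoeffSolver

module _ where
  open import Data.Nat
  open import Data.Nat.Properties
  open import Data.Nat.DivMod using (m/n*n≡m)
  open import Data.Nat.Combinatorics using (nCk≡n!/k![n-k]!; k![n∸k]!∣n!)
  open import Data.Nat.Solver using (module +-*-Solver)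
  open import Relation.Binary.PropositionalEquality
  open import Relation.Nullary using (yes; no)
  open ≡-Reasoning
  open +-*-Solver

  m∸n∸o≡m∸o∸n : ∀ m n o → m ∸ n ∸ o ≡ m ∸ o ∸ n
  m∸n∸o≡m∸o∸n m n o = begin
    m ∸ n ∸ o   ≡⟨ ∸-+-assoc m n o ⟩
    m ∸ (n + o) ≡⟨ cong (m ∸_) (+-comm n o) ⟩
    m ∸ (o + n) ≡⟨ ∸-+-assoc m o n ⟨
    m ∸ o ∸ n   ∎

  n!≡nCk*[k!*[n∸k]!] : ∀ {n k} → k ≤ n → n ! ≡ (n C k) * (k ! * (n ∸ k) !)
  n!≡nCk*[k!*[n∸k]!] {n} {k} k≤n = begin
    n !                                         ≡⟨ m/n*n≡m (k![n∸k]!∣n! k≤n) ⟨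
    n ! / (k ! * (n ∸ k) !) * (k ! * (n ∸ k) !) ≡⟨ cong (_* (k ! * (n ∸ k) !)) (nCk≡n!/k![n-k]! k≤n) ⟨
    (n C k) * (k ! * (n ∸ k) !)                 ∎
    where instance _ = k !* (n ∸ k) !≢0

  n!≡nCl*[n∸l]Ci*[l!*[i!*[n∸l∸i]!]] : ∀ {n} l i → l + i ≤ n →
    n ! ≡ (n C l) * ((n ∸ l) C i) * (l ! * (i ! * (n ∸ l ∸ i) !))
  n!≡nCl*[n∸l]Ci*[l!*[i!*[n∸l∸i]!]] {n} l i l+i≤n = begin
    n !
      ≡⟨ n!≡nCk*[k!*[n∸k]!] (m+n≤o⇒m≤o l l+i≤n) ⟩
    (n C l) * (l ! * (n ∸ l) !)
      ≡⟨ cong (λ z → (n C l) * (l ! * z)) (n!≡nCk*[k!*[n∸k]!] i≤n∸l) ⟩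
    (n C l) * (l ! * (((n ∸ l) C i) * (i ! * (n ∸ l ∸ i) !)))
      ≡⟨ solve 5 (λ a b c d e → a :* (c :* (b :* (d :* e))) := a :* b :* (c :* (d :* e))) refl
               (n C l) ((n ∸ l) C i) (l !) (i !) ((n ∸ l ∸ i) !) ⟩
    (n C l) * ((n ∸ l) C i) * (l ! * (i ! * (n ∸ l ∸ i) !)) ∎
    where
    i≤n∸l : i ≤ n ∸ l
    i≤n∸l = m+n≤o⇒m≤o∸n i (subst (_≤ n) (+-comm l i) l+i≤n)

  nCl*[n∸l]Ci≡nCi*[n∸i]Cl : ∀ n l i → (n C l) * ((n ∸ l) C i) ≡ (n C i) * ((n ∸ i) C l)
  nCl*[n∸l]Ci≡nCi*[n∸i]Cl n l         zero      = trans (*-identityʳ (n C l)) (sym (*-identityˡ (n C l)))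
  nCl*[n∸l]Ci≡nCi*[n∸i]Cl n zero      i@(suc _) = trans (*-identityˡ (n C i)) (sym (*-identityʳ (n C i)))
  nCl*[n∸l]Ci≡nCi*[n∸i]Cl n l@(suc _) i@(suc _) with l + i ≤? n
  ... | yes l+i≤n = *-cancelʳ-≡ _ _ (l ! * (i ! * (n ∸ l ∸ i) !)) (begin
    (n C l) * ((n ∸ l) C i) * (l ! * (i ! * (n ∸ l ∸ i) !))
      ≡⟨ n!≡nCl*[n∸l]Ci*[l!*[i!*[n∸l∸i]!]] l i l+i≤n ⟨
    n !
      ≡⟨ n!≡nCl*[n∸l]Ci*[l!*[i!*[n∸l∸i]!]] i l (subst (_≤ n) (+-comm l i) l+i≤n) ⟩
    (n C i) * ((n ∸ i) C l) * (i ! * (l ! * (n ∸ i ∸ l) !))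
      ≡⟨ cong ((n C i) * ((n ∸ i) C l) *_)
              (solve 3 (λ a b c → b :* (a :* c) := a :* (b :* c)) refl (l !) (i !) ((n ∸ i ∸ l) !)) ⟩
    (n C i) * ((n ∸ i) C l) * (l ! * (i ! * (n ∸ i ∸ l) !))
      ≡⟨ cong (λ c → (n C i) * ((n ∸ i) C l) * (l ! * (i ! * c !))) (m∸n∸o≡m∸o∸n n i l) ⟩
    (n C i) * ((n ∸ i) C l) * (l ! * (i ! * (n ∸ l ∸ i) !)) ∎)
    where instance _ = m*n≢0 (l !) (i ! * (n ∸ l ∸ i) !) {{l !≢0}} {{i !* (n ∸ l ∸ i) !≢0}}
  ... | no l+i≰n = begin
    (n C l) * ((n ∸ l) C i) ≡⟨ cong ((n C l) *_) (k>n⇒nCk≡0 (m<n+o⇒m∸n<o n l n<l+i)) ⟩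
    (n C l) * 0             ≡⟨ *-zeroʳ (n C l) ⟩
    0                       ≡⟨ *-zeroʳ (n C i) ⟨
    (n C i) * 0             ≡⟨ cong ((n C i) *_) (k>n⇒nCk≡0 (m<n+o⇒m∸n<o n i (subst (n <_) (+-comm l i) n<l+i))) ⟨
    (n C i) * ((n ∸ i) C l) ∎
    where n<l+i = ≰⇒> l+i≰n

  S2-< : ∀ {l m} → l < m → S2 l m ≡ 0
  S2-< {zero}  {suc m} _ = refl
  S2-< {suc l} {suc m} (s≤s l<m)
    rewrite S2-< {l} {suc m} (m<n⇒m<1+n l<m) | S2-< l<m = trans (+-identityʳ _) (*-zeroʳ m)

module _ {c ℓ : Level} (R : CommutativeRing c ℓ) where
  open CommutativeRing R
  open import Relation.Binary.Reasoning.Setoid setoid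
  open NatCoeffSolver commutativeSemiring using (solve; _:+_; _:*_; _:=_)
  open AbelianGroupProperties +-abelianGroup using (⁻¹-∙-comm)

  ι-+ : ∀ m n → ι R (m +ℕ n) ≈ ι R m + ι R n
  ι-+ zero    n = sym (+-identityˡ _)
  ι-+ (suc m) n = trans (+-congˡ (ι-+ m n)) (sym (+-assoc _ _ _))

  ι-* : ∀ m n → ι R (m *ℕ n) ≈ ι R m * ι R n
  ι-* zero    n = sym (zeroˡ _)
  ι-* (suc m) n = begin
    ι R (n +ℕ m *ℕ n)          ≈⟨ ι-+ n (m *ℕ n) ⟩
    ι R n + ι R (m *ℕ n)       ≈⟨ +-cong (sym (*-identityˡ _)) (ι-* m n) ⟩
    1# * ι R n + ι R m * ι R n ≈⟨ distribʳ _ _ _ ⟨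
    (1# + ι R m) * ι R n       ∎

  ι≈0 : ∀ {m} → m ≡ 0 → ι R m ≈ 0#
  ι≈0 ≡.refl = refl

  ι-nCl*[n∸l]Ci : ∀ n l i → ι R (n C l) * ι R ((n ∸ l) C i) ≈ ι R (n C i) * ι R ((n ∸ i) C l)
  ι-nCl*[n∸l]Ci n l i = begin
    ι R (n C l) * ι R ((n ∸ l) C i) ≈⟨ ι-* (n C l) _ ⟨
    ι R ((n C l) *ℕ ((n ∸ l) C i))  ≡⟨ ≡.cong (ι R) (nCl*[n∸l]Ci≡nCi*[n∸i]Cl n l i) ⟩
    ι R ((n C i) *ℕ ((n ∸ i) C l))  ≈⟨ ι-* (n C i) _ ⟩
    ι R (n C i) * ι R ((n ∸ i) C l) ∎

  pow-cong : ∀ {x y} n → x ≈ y → pow R x n ≈ pow R y n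
  pow-cong zero    x≈y = refl
  pow-cong (suc n) x≈y = *-cong (pow-cong n x≈y) x≈y

  rising-suc : ∀ x m → rising R x (suc m) ≈ x * rising R (x + 1#) m
  rising-suc x zero    = trans (*-identityˡ _) (trans (+-identityʳ x) (sym (*-identityʳ x)))
  rising-suc x (suc m) = begin
    rising R x (suc m) * (x + ι R (suc m))          ≈⟨ *-congʳ (rising-suc x m) ⟩
    x * rising R (x + 1#) m * (x + (1# + ι R m))
      ≈⟨ solve 4 (λ x r a b → x :* r :* (x :+ (a :+ b)) := x :* (r :* ((x :+ a) :+ b))) refl x _ 1# (ι R m) ⟩
    x * (rising R (x + 1#) m * ((x + 1#) + ι R m)) ∎

  sumTo-cong : ∀ n {f g} → (∀ i → i ≤ n → f i ≈ g i) → sumTo R n f ≈ sumTo R n g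
  sumTo-cong zero    f≈g = f≈g 0 ℕₚ.≤-refl
  sumTo-cong (suc n) f≈g =
    +-cong (sumTo-cong n (λ i i≤n → f≈g i (ℕₚ.m≤n⇒m≤1+n i≤n))) (f≈g (suc n) ℕₚ.≤-refl)

  sumTo-zero : ∀ n {f} → (∀ i → i ≤ n → f i ≈ 0#) → sumTo R n f ≈ 0#
  sumTo-zero n f≈0 = trans (sumTo-cong n f≈0) (sumTo-0# n)
    where
    sumTo-0# : ∀ n → sumTo R n (λ _ → 0#) ≈ 0#
    sumTo-0# zero    = refl
    sumTo-0# (suc n) = trans (+-identityʳ _) (sumTo-0# n)

  sumTo-distrib-+ : ∀ n f g → sumTo R n (λ i → f i + g i) ≈ sumTo R n f + sumTo R n g
  sumTo-distrib-+ zero    f g = refl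
  sumTo-distrib-+ (suc n) f g = begin
    sumTo R n (λ i → f i + g i) + (f (suc n) + g (suc n))   ≈⟨ +-congʳ (sumTo-distrib-+ n f g) ⟩
    (sumTo R n f + sumTo R n g) + (f (suc n) + g (suc n))
      ≈⟨ solve 4 (λ a b c d → (a :+ b) :+ (c :+ d) := (a :+ c) :+ (b :+ d)) refl _ _ _ _ ⟩
    (sumTo R n f + f (suc n)) + (sumTo R n g + g (suc n))   ∎

  *-distribˡ-sumTo : ∀ n a f → a * sumTo R n f ≈ sumTo R n (λ i → a * f i)
  *-distribˡ-sumTo zero    a f = refl
  *-distribˡ-sumTo (suc n) a f = trans (distribˡ a _ _) (+-congʳ (*-distribˡ-sumTo n a f))

  *-distribʳ-sumTo : ∀ n a f → sumTo R n f * a ≈ sumTo R n (λ i → f i * a)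
  *-distribʳ-sumTo n a f = begin
    sumTo R n f * a             ≈⟨ *-comm _ a ⟩
    a * sumTo R n f             ≈⟨ *-distribˡ-sumTo n a f ⟩
    sumTo R n (λ i → a * f i)   ≈⟨ sumTo-cong n (λ i _ → *-comm a (f i)) ⟩
    sumTo R n (λ i → f i * a)   ∎

  sumTo-head : ∀ n f → sumTo R (suc n) f ≈ f 0 + sumTo R n (λ i → f (suc i))
  sumTo-head zero    f = refl
  sumTo-head (suc n) f = trans (+-congʳ (sumTo-head n f)) (+-assoc _ _ _)

  sumTo-comm : ∀ n m (F : ℕ → ℕ → Carrier) →
               sumTo R n (λ i → sumTo R m (F i)) ≈ sumTo R m (λ j → sumTo R n (λ i → F i j))
  sumTo-comm zero    m F = refl
  sumTo-comm (suc n) m F = begin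
    sumTo R n (λ i → sumTo R m (F i)) + sumTo R m (F (suc n))     ≈⟨ +-congʳ (sumTo-comm n m F) ⟩
    sumTo R m (λ j → sumTo R n (λ i → F i j)) + sumTo R m (F (suc n)) ≈⟨ sumTo-distrib-+ m _ _ ⟨
    sumTo R m (λ j → sumTo R n (λ i → F i j) + F (suc n) j)       ∎

  sumTo-extend : ∀ {N M} f → N ≤ M → (∀ i → N < i → f i ≈ 0#) → sumTo R M f ≈ sumTo R N f
  sumTo-extend {N} f N≤M f>N≈0 = go (ℕₚ.≤⇒≤′ N≤M)
    where
    go : ∀ {M} → N ≤′ M → sumTo R M f ≈ sumTo R N f
    go ≤′-refl      = refl
    go (≤′-step N≤′M) = trans (+-cong (go N≤′M) (f>N≈0 _ (s≤s (ℕₚ.≤′⇒≤ N≤′M)))) (+-identityʳ _)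

  sumFrom : ℕ → (ℕ → Carrier) → ℕ → Carrier
  sumFrom a f zero    = 0#
  sumFrom a f (suc k) = sumFrom a f k + f (a +ℕ k)

  -- sumFromTo is computed by a local copy of sumFrom; the meta `go` is solved to that copy.
  sumFromTo≈sumFrom : ∀ a b f → sumFromTo R a b f ≈ sumFrom a f (suc b ∸ a)
  sumFromTo≈sumFrom a b f = trans (reflexive unfold) (go≈sumFrom (suc b ∸ a))
    where
    go : ℕ → Carrier
    go = _
    unfold : sumFromTo R a b f ≡ go (suc b ∸ a)
    unfold with suc b ∸ a
    ... | _ = ≡.refl
    go≈sumFrom : ∀ k → go k ≈ sumFrom a f k
    go≈sumFrom zero    = refl
    go≈sumFrom (suc k) = +-congʳ (go≈sumFrom k)

  sumTo≈sumFrom : ∀ b f → sumTo R b f ≈ sumFrom 0 f (suc b)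
  sumTo≈sumFrom zero    f = sym (+-identityˡ _)
  sumTo≈sumFrom (suc b) f = +-congʳ (sumTo≈sumFrom b f)

  sumFrom-skip : ∀ a f → (∀ l → l < a → f l ≈ 0#) → ∀ k → sumFrom 0 f (k +ℕ a) ≈ sumFrom a f k
  sumFrom-skip a f f<a≈0 zero    = prefix a ℕₚ.≤-refl
    where
    prefix : ∀ j → j ≤ a → sumFrom 0 f j ≈ 0#
    prefix zero    _   = refl
    prefix (suc j) j<a = trans (+-cong (prefix j (ℕₚ.<⇒≤ j<a)) (f<a≈0 j j<a)) (+-identityʳ 0#)
  sumFrom-skip a f f<a≈0 (suc k) =
    +-cong (sumFrom-skip a f f<a≈0 k) (reflexive (≡.cong f (ℕₚ.+-comm k a)))

  sumFromTo≈sumTo : ∀ a b f → a ≤ suc b → (∀ l → l < a → f l ≈ 0#) → sumFromTo R a b f ≈ sumTo R b f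
  sumFromTo≈sumTo a b f a≤1+b f<a≈0 = begin
    sumFromTo R a b f                  ≈⟨ sumFromTo≈sumFrom a b f ⟩
    sumFrom a f (suc b ∸ a)            ≈⟨ sumFrom-skip a f f<a≈0 (suc b ∸ a) ⟨
    sumFrom 0 f ((suc b ∸ a) +ℕ a)     ≡⟨ ≡.cong (sumFrom 0 f) (ℕₚ.m∸n+n≡m a≤1+b) ⟩
    sumFrom 0 f (suc b)                ≈⟨ sumTo≈sumFrom b f ⟨
    sumTo R b f                        ∎

  binomialSum-extend : ∀ {N M} (φ : ℕ → Carrier) → N ≤ M →
    sumTo R M (λ i → ι R (N C i) * φ i) ≈ sumTo R N (λ i → ι R (N C i) * φ i)
  binomialSum-extend φ N≤M =
    sumTo-extend _ N≤M (λ i N<i → trans (*-congʳ (ι≈0 (k>n⇒nCk≡0 N<i))) (zeroˡ (φ i)))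

  binomialSum-pascal : ∀ N (φ : ℕ → Carrier) → sumTo R (suc N) (λ l → ι R (suc N C l) * φ l)
    ≈ sumTo R N (λ l → ι R (N C l) * φ l) + sumTo R N (λ l → ι R (N C l) * φ (suc l))
  binomialSum-pascal N φ = begin
    sumTo R (suc N) (λ l → ι R (suc N C l) * φ l)
      ≈⟨ sumTo-cong (suc N) (λ l _ → trans (*-congʳ (trans (reflexive (≡.cong (ι R) (pascal l))) (ι-+ (N C l) (C⁻ l))))
                                           (distribʳ (φ l) _ _)) ⟩
    sumTo R (suc N) (λ l → ι R (N C l) * φ l + ι R (C⁻ l) * φ l)
      ≈⟨ sumTo-distrib-+ (suc N) (λ l → ι R (N C l) * φ l) (λ l → ι R (C⁻ l) * φ l) ⟩
    sumTo R (suc N) (λ l → ι R (N C l) * φ l) + sumTo R (suc N) (λ l → ι R (C⁻ l) * φ l)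
      ≈⟨ +-cong (binomialSum-extend φ (ℕₚ.n≤1+n N)) (sumTo-head N (λ l → ι R (C⁻ l) * φ l)) ⟩
    sumTo R N (λ l → ι R (N C l) * φ l) + (0# * φ 0 + sumTo R N (λ l → ι R (N C l) * φ (suc l)))
      ≈⟨ +-congˡ (trans (+-congʳ (zeroˡ (φ 0))) (+-identityˡ _)) ⟩
    sumTo R N (λ l → ι R (N C l) * φ l) + sumTo R N (λ l → ι R (N C l) * φ (suc l)) ∎
    where
    C⁻ : ℕ → ℕ
    C⁻ zero    = 0
    C⁻ (suc l) = N C l
    pascal : ∀ l → suc N C l ≡ N C l +ℕ C⁻ l
    pascal zero    = ≡.refl
    pascal (suc l) = ≡.trans (≡.sym (nCk+nC[k+1]≡[n+1]C[k+1] N l)) (ℕₚ.+-comm (N C l) (N C suc l))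

  -- N!/m! times the coefficient of t^N in (e^t - 1)^m e^{y t}
  binomStirling : ℕ → ℕ → Carrier → Carrier
  binomStirling m N y = sumTo R N (λ l → ι R (N C l) * (ι R (S2 l m) * pow R y (N ∸ l)))

  binomStirling⁻ : ℕ → ℕ → Carrier → Carrier
  binomStirling⁻ zero    N y = 0#
  binomStirling⁻ (suc m) N y = binomStirling m N y

  binomStirling-cong : ∀ m N {y y′} → y ≈ y′ → binomStirling m N y ≈ binomStirling m N y′
  binomStirling-cong m N y≈y′ = sumTo-cong N (λ l _ → *-congˡ (*-congˡ (pow-cong (N ∸ l) y≈y′)))

  binomStirling-vanishes : ∀ m N y → N < m → binomStirling m N y ≈ 0#
  binomStirling-vanishes m N y N<m = sumTo-zero N (λ l l≤N → begin
    ι R (N C l) * (ι R (S2 l m) * pow R y (N ∸ l)) ≈⟨ *-congˡ (*-congʳ (ι≈0 (S2-< (ℕₚ.≤-<-trans l≤N N<m)))) ⟩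
    ι R (N C l) * (0# * pow R y (N ∸ l))           ≈⟨ *-congˡ (zeroˡ _) ⟩
    ι R (N C l) * 0#                               ≈⟨ zeroʳ _ ⟩
    0#                                             ∎)

  binomStirling-S2-suc : ∀ m N y →
    sumTo R N (λ l → ι R (N C l) * (ι R (S2 (suc l) m) * pow R y (N ∸ l)))
      ≈ ι R m * binomStirling m N y + binomStirling⁻ m N y
  binomStirling-S2-suc zero    N y = begin
    sumTo R N (λ l → ι R (N C l) * (0# * pow R y (N ∸ l)))
      ≈⟨ sumTo-zero N (λ l _ → trans (*-congˡ (zeroˡ _)) (zeroʳ _)) ⟩
    0#                                                     ≈⟨ trans (+-identityʳ _) (zeroˡ _) ⟨
    0# * binomStirling 0 N y + 0#                          ∎
  binomStirling-S2-suc (suc m) N y = begin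
    sumTo R N (λ l → ι R (N C l) * (ι R (S2 (suc l) (suc m)) * pow R y (N ∸ l)))
      ≈⟨ sumTo-cong N (λ l _ → split l) ⟩
    sumTo R N (λ l → ι R (suc m) * (ι R (N C l) * (ι R (S2 l (suc m)) * pow R y (N ∸ l)))
                     + ι R (N C l) * (ι R (S2 l m) * pow R y (N ∸ l)))
      ≈⟨ sumTo-distrib-+ N _ _ ⟩
    sumTo R N (λ l → ι R (suc m) * (ι R (N C l) * (ι R (S2 l (suc m)) * pow R y (N ∸ l))))
      + binomStirling m N y
      ≈⟨ +-congʳ (*-distribˡ-sumTo N _ _) ⟨
    ι R (suc m) * binomStirling (suc m) N y + binomStirling m N y ∎
    where
    split : ∀ l → ι R (N C l) * (ι R (S2 (suc l) (suc m)) * pow R y (N ∸ l))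
                  ≈ ι R (suc m) * (ι R (N C l) * (ι R (S2 l (suc m)) * pow R y (N ∸ l)))
                    + ι R (N C l) * (ι R (S2 l m) * pow R y (N ∸ l))
    split l = begin
      ι R (N C l) * (ι R (suc m *ℕ S2 l (suc m) +ℕ S2 l m) * pow R y (N ∸ l))
        ≈⟨ *-congˡ (*-congʳ (trans (ι-+ (suc m *ℕ S2 l (suc m)) _) (+-congʳ (ι-* (suc m) (S2 l (suc m)))))) ⟩
      ι R (N C l) * ((ι R (suc m) * ι R (S2 l (suc m)) + ι R (S2 l m)) * pow R y (N ∸ l))
        ≈⟨ solve 5 (λ c a s s′ p → c :* ((a :* s :+ s′) :* p) := a :* (c :* (s :* p)) :+ c :* (s′ :* p))
                   refl _ _ _ _ _ ⟩
      ι R (suc m) * (ι R (N C l) * (ι R (S2 l (suc m)) * pow R y (N ∸ l)))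
        + ι R (N C l) * (ι R (S2 l m) * pow R y (N ∸ l)) ∎

  binomStirling-suc : ∀ m N y →
    binomStirling m (suc N) y ≈ (y + ι R m) * binomStirling m N y + binomStirling⁻ m N y
  binomStirling-suc m N y = begin
    binomStirling m (suc N) y
      ≈⟨ binomialSum-pascal N (λ l → ι R (S2 l m) * pow R y (suc N ∸ l)) ⟩
    sumTo R N (λ l → ι R (N C l) * (ι R (S2 l m) * pow R y (suc N ∸ l)))
      + sumTo R N (λ l → ι R (N C l) * (ι R (S2 (suc l) m) * pow R y (N ∸ l)))
      ≈⟨ +-cong lowerDegree (binomStirling-S2-suc m N y) ⟩
    y * binomStirling m N y + (ι R m * binomStirling m N y + binomStirling⁻ m N y)
      ≈⟨ solve 4 (λ y b a d → y :* b :+ (a :* b :+ d) := (y :+ a) :* b :+ d) refl _ _ _ _ ⟩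
    (y + ι R m) * binomStirling m N y + binomStirling⁻ m N y ∎
    where
    lowerDegree : sumTo R N (λ l → ι R (N C l) * (ι R (S2 l m) * pow R y (suc N ∸ l))) ≈ y * binomStirling m N y
    lowerDegree = begin
      sumTo R N (λ l → ι R (N C l) * (ι R (S2 l m) * pow R y (suc N ∸ l)))
        ≈⟨ sumTo-cong N (λ l l≤N → begin
             ι R (N C l) * (ι R (S2 l m) * pow R y (suc N ∸ l))
               ≡⟨ ≡.cong (λ k → ι R (N C l) * (ι R (S2 l m) * pow R y k)) (ℕₚ.+-∸-assoc 1 l≤N) ⟩
             ι R (N C l) * (ι R (S2 l m) * (pow R y (N ∸ l) * y))
               ≈⟨ solve 4 (λ c s p y → c :* (s :* (p :* y)) := y :* (c :* (s :* p))) refl _ _ _ _ ⟩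
             y * (ι R (N C l) * (ι R (S2 l m) * pow R y (N ∸ l))) ∎) ⟩
      sumTo R N (λ l → y * (ι R (N C l) * (ι R (S2 l m) * pow R y (N ∸ l))))
        ≈⟨ *-distribˡ-sumTo N y _ ⟨
      y * binomStirling m N y ∎

  pow-+≈risingSum : ∀ N x y →
    pow R (x + y) N ≈ sumTo R N (λ m → rising R x m * binomStirling m N (y - ι R m))
  pow-+≈risingSum zero    x y =
    sym (trans (*-identityˡ _) (trans (*-cong ι1≈1 (trans (*-congʳ ι1≈1) (*-identityˡ 1#))) (*-identityˡ 1#)))
    where
    ι1≈1 : ι R 1 ≈ 1#
    ι1≈1 = +-identityʳ 1#
  pow-+≈risingSum (suc N) x y = begin
    pow R (x + y) N * (x + y)
      ≈⟨ solve 3 (λ p x y → p :* (x :+ y) := y :* p :+ x :* p) refl _ x y ⟩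
    y * pow R (x + y) N + x * pow R (x + y) N
      ≈⟨ +-cong lowerTerms upperTerms ⟨
    sumTo R (suc N) (λ m → y * (rising R x m * binomStirling m N (y - ι R m)))
      + sumTo R (suc N) (λ m → rising R x m * binomStirling⁻ m N (y - ι R m))
      ≈⟨ sumTo-distrib-+ (suc N) _ _ ⟨
    sumTo R (suc N) (λ m → y * (rising R x m * binomStirling m N (y - ι R m))
                           + rising R x m * binomStirling⁻ m N (y - ι R m))
      ≈⟨ sumTo-cong (suc N) (λ m _ → recurrence m) ⟨
    sumTo R (suc N) (λ m → rising R x m * binomStirling m (suc N) (y - ι R m)) ∎
    where
    recurrence : ∀ m → rising R x m * binomStirling m (suc N) (y - ι R m)
      ≈ y * (rising R x m * binomStirling m N (y - ι R m)) + rising R x m * binomStirling⁻ m N (y - ι R m)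
    recurrence m = begin
      rising R x m * binomStirling m (suc N) (y - ι R m)
        ≈⟨ *-congˡ (binomStirling-suc m N _) ⟩
      rising R x m * (((y - ι R m) + ι R m) * binomStirling m N (y - ι R m) + binomStirling⁻ m N (y - ι R m))
        ≈⟨ solve 4 (λ r u b b⁻ → r :* (u :* b :+ b⁻) := u :* (r :* b) :+ r :* b⁻) refl _ _ _ _ ⟩
      ((y - ι R m) + ι R m) * (rising R x m * binomStirling m N (y - ι R m)) + rising R x m * binomStirling⁻ m N (y - ι R m)
        ≈⟨ +-congʳ (*-congʳ (trans (+-assoc _ _ _) (trans (+-congˡ (-‿inverseˡ (ι R m))) (+-identityʳ y)))) ⟩
      y * (rising R x m * binomStirling m N (y - ι R m)) + rising R x m * binomStirling⁻ m N (y - ι R m) ∎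

    lowerTerms : sumTo R (suc N) (λ m → y * (rising R x m * binomStirling m N (y - ι R m))) ≈ y * pow R (x + y) N
    lowerTerms = begin
      sumTo R (suc N) (λ m → y * (rising R x m * binomStirling m N (y - ι R m)))
        ≈⟨ sumTo-extend _ (ℕₚ.n≤1+n N) (λ m N<m →
             trans (*-congˡ (trans (*-congˡ (binomStirling-vanishes m N _ N<m)) (zeroʳ _))) (zeroʳ y)) ⟩
      sumTo R N (λ m → y * (rising R x m * binomStirling m N (y - ι R m)))
        ≈⟨ *-distribˡ-sumTo N y _ ⟨
      y * sumTo R N (λ m → rising R x m * binomStirling m N (y - ι R m))
        ≈⟨ *-congˡ (pow-+≈risingSum N x y) ⟨
      y * pow R (x + y) N ∎

    -- the m-th term is the (m - 1)-st term of the sum for x + 1 and y - 1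
    upperTerms : sumTo R (suc N) (λ m → rising R x m * binomStirling⁻ m N (y - ι R m)) ≈ x * pow R (x + y) N
    upperTerms = begin
      sumTo R (suc N) (λ m → rising R x m * binomStirling⁻ m N (y - ι R m))
        ≈⟨ sumTo-head N _ ⟩
      1# * 0# + sumTo R N (λ m → rising R x (suc m) * binomStirling m N (y - ι R (suc m)))
        ≈⟨ +-cong (zeroʳ 1#) (sumTo-cong N (λ m _ → *-cong (rising-suc x m) (binomStirling-cong m N (shift (ι R m))))) ⟩
      0# + sumTo R N (λ m → x * rising R (x + 1#) m * binomStirling m N ((y - 1#) - ι R m))
        ≈⟨ +-identityˡ _ ⟩
      sumTo R N (λ m → x * rising R (x + 1#) m * binomStirling m N ((y - 1#) - ι R m))
        ≈⟨ sumTo-cong N (λ m _ → *-assoc _ _ _) ⟩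
      sumTo R N (λ m → x * (rising R (x + 1#) m * binomStirling m N ((y - 1#) - ι R m)))
        ≈⟨ *-distribˡ-sumTo N x _ ⟨
      x * sumTo R N (λ m → rising R (x + 1#) m * binomStirling m N ((y - 1#) - ι R m))
        ≈⟨ *-congˡ (pow-+≈risingSum N (x + 1#) (y - 1#)) ⟨
      x * pow R ((x + 1#) + (y - 1#)) N
        ≈⟨ *-congˡ (pow-cong N rebalance) ⟩
      x * pow R (x + y) N ∎
      where
      shift : ∀ a → y - (1# + a) ≈ (y - 1#) - a
      shift a = trans (+-congˡ (sym (⁻¹-∙-comm 1# a))) (sym (+-assoc _ _ _))
      rebalance : (x + 1#) + (y - 1#) ≈ x + y
      rebalance = begin
        (x + 1#) + (y - 1#) ≈⟨ solve 4 (λ x y a b → (x :+ a) :+ (y :+ b) := (x :+ y) :+ (a :+ b)) refl x y 1# (- 1#) ⟩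
        (x + y) + (1# - 1#) ≈⟨ +-congˡ (-‿inverseʳ 1#) ⟩
        (x + y) + 0#        ≈⟨ +-identityʳ _ ⟩
        x + y               ∎

  pow≈risingSum : ∀ N x → pow R x N ≈ sumTo R N (λ m → rising R x m * binomStirling m N (- ι R m))
  pow≈risingSum N x = begin
    pow R x N                                                          ≈⟨ pow-cong N (+-identityʳ x) ⟨
    pow R (x + 0#) N                                                   ≈⟨ pow-+≈risingSum N x 0# ⟩
    sumTo R N (λ m → rising R x m * binomStirling m N (0# - ι R m))
      ≈⟨ sumTo-cong N (λ m _ → *-congˡ (binomStirling-cong m N (+-identityˡ _))) ⟩
    sumTo R N (λ m → rising R x m * binomStirling m N (- ι R m))       ∎

  egfCoeff : FPS R → ℕ → Carrier
  egfCoeff g n = ι R (n !) * g n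

  module _ (F : CharZeroField R) where
    open CharZeroField F
    open WithField R F

    ι[n!]*invFact≈1 : ∀ n → ι R (n !) * invFact n ≈ 1#
    ι[n!]*invFact≈1 zero    = trans (*-identityʳ _) (+-identityʳ 1#)
    ι[n!]*invFact≈1 (suc n) = begin
      ι R (suc n *ℕ n !) * (invFact n * inv (ι R (suc n)) (char0 n))
        ≈⟨ *-congʳ (ι-* (suc n) (n !)) ⟩
      ι R (suc n) * ι R (n !) * (invFact n * inv (ι R (suc n)) (char0 n))
        ≈⟨ solve 4 (λ a b c d → a :* b :* (c :* d) := b :* c :* (a :* d)) refl _ _ _ _ ⟩
      ι R (n !) * invFact n * (ι R (suc n) * inv (ι R (suc n)) (char0 n))
        ≈⟨ *-cong (ι[n!]*invFact≈1 n) (inv-correct _ (char0 n)) ⟩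
      1# * 1#
        ≈⟨ *-identityʳ 1# ⟩
      1# ∎

    egfCoeff-⊛-expS : ∀ g y n →
      egfCoeff (_⊛_ R g (expS y)) n ≈ sumTo R n (λ i → ι R (n C i) * (egfCoeff g i * pow R y (n ∸ i)))
    egfCoeff-⊛-expS g y n = trans (*-distribˡ-sumTo n _ _) (sumTo-cong n (λ i i≤n → begin
      ι R (n !) * (g i * (pow R y (n ∸ i) * invFact (n ∸ i)))
        ≈⟨ *-congʳ (ι-n! i≤n) ⟩
      ι R (n C i) * (ι R (i !) * ι R ((n ∸ i) !)) * (g i * (pow R y (n ∸ i) * invFact (n ∸ i)))
        ≈⟨ solve 6 (λ c a b g p v → c :* (a :* b) :* (g :* (p :* v)) := c :* (a :* g :* p) :* (b :* v)) refl _ _ _ _ _ _ ⟩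
      ι R (n C i) * (egfCoeff g i * pow R y (n ∸ i)) * (ι R ((n ∸ i) !) * invFact (n ∸ i))
        ≈⟨ *-congˡ (ι[n!]*invFact≈1 (n ∸ i)) ⟩
      ι R (n C i) * (egfCoeff g i * pow R y (n ∸ i)) * 1#
        ≈⟨ *-identityʳ _ ⟩
      ι R (n C i) * (egfCoeff g i * pow R y (n ∸ i)) ∎))
      where
      ι-n! : ∀ {i} → i ≤ n → ι R (n !) ≈ ι R (n C i) * (ι R (i !) * ι R ((n ∸ i) !))
      ι-n! {i} i≤n = begin
        ι R (n !)                                        ≡⟨ ≡.cong (ι R) (n!≡nCk*[k!*[n∸k]!] i≤n) ⟩
        ι R ((n C i) *ℕ (i ! *ℕ (n ∸ i) !))              ≈⟨ ι-* (n C i) _ ⟩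
        ι R (n C i) * ι R (i ! *ℕ (n ∸ i) !)             ≈⟨ *-congˡ (ι-* (i !) _) ⟩
        ι R (n C i) * (ι R (i !) * ι R ((n ∸ i) !))      ∎

    stirlingSum-⊛-expS : ∀ g y {m n} → m ≤ n →
      sumFromTo R m n (λ l → ι R (S2 l m) * ι R (n C l) * egfCoeff (_⊛_ R g (expS y)) (n ∸ l))
        ≈ sumTo R n (λ i → ι R (n C i) * (egfCoeff g i * binomStirling m (n ∸ i) y))
    stirlingSum-⊛-expS g y {m} {n} m≤n = begin
      sumFromTo R m n (λ l → ι R (S2 l m) * ι R (n C l) * egfCoeff (_⊛_ R g (expS y)) (n ∸ l))
        ≈⟨ sumFromTo≈sumTo m n _ (ℕₚ.m≤n⇒m≤1+n m≤n)
             (λ l l<m → trans (*-congʳ (trans (*-congʳ (ι≈0 (S2-< l<m))) (zeroˡ _))) (zeroˡ _)) ⟩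
      sumTo R n (λ l → ι R (S2 l m) * ι R (n C l) * egfCoeff (_⊛_ R g (expS y)) (n ∸ l))
        ≈⟨ sumTo-cong n (λ l _ → *-congˡ (trans (egfCoeff-⊛-expS g y (n ∸ l))
                                                 (sym (binomialSum-extend _ (ℕₚ.m∸n≤m n l))))) ⟩
      sumTo R n (λ l → ι R (S2 l m) * ι R (n C l)
                       * sumTo R n (λ i → ι R ((n ∸ l) C i) * (egfCoeff g i * pow R y (n ∸ l ∸ i))))
        ≈⟨ sumTo-cong n (λ l _ → trans (*-distribˡ-sumTo n _ _) (sumTo-cong n (λ i _ → reorder l i))) ⟩
      sumTo R n (λ l → sumTo R n (λ i → ι R (n C i) * (egfCoeff g i * term i l)))
        ≈⟨ sumTo-comm n n _ ⟩
      sumTo R n (λ i → sumTo R n (λ l → ι R (n C i) * (egfCoeff g i * term i l)))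
        ≈⟨ sumTo-cong n (λ i _ → factor i) ⟨
      sumTo R n (λ i → ι R (n C i) * (egfCoeff g i * sumTo R n (term i)))
        ≈⟨ sumTo-cong n (λ i _ → *-congˡ (*-congˡ (binomialSum-extend _ (ℕₚ.m∸n≤m n i)))) ⟩
      sumTo R n (λ i → ι R (n C i) * (egfCoeff g i * binomStirling m (n ∸ i) y)) ∎
      where
      term : ℕ → ℕ → Carrier
      term i l = ι R ((n ∸ i) C l) * (ι R (S2 l m) * pow R y (n ∸ i ∸ l))
      reorder : ∀ l i → ι R (S2 l m) * ι R (n C l) * (ι R ((n ∸ l) C i) * (egfCoeff g i * pow R y (n ∸ l ∸ i)))
                        ≈ ι R (n C i) * (egfCoeff g i * term i l)
      reorder l i = begin
        ι R (S2 l m) * ι R (n C l) * (ι R ((n ∸ l) C i) * (egfCoeff g i * pow R y (n ∸ l ∸ i)))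
          ≈⟨ solve 5 (λ s a b h p → s :* a :* (b :* (h :* p)) := (a :* b) :* (h :* (s :* p))) refl _ _ _ _ _ ⟩
        (ι R (n C l) * ι R ((n ∸ l) C i)) * (egfCoeff g i * (ι R (S2 l m) * pow R y (n ∸ l ∸ i)))
          ≈⟨ *-cong (ι-nCl*[n∸l]Ci n l i)
                    (*-congˡ (*-congˡ (reflexive (≡.cong (pow R y) (m∸n∸o≡m∸o∸n n l i))))) ⟩
        (ι R (n C i) * ι R ((n ∸ i) C l)) * (egfCoeff g i * (ι R (S2 l m) * pow R y (n ∸ i ∸ l)))
          ≈⟨ solve 5 (λ a b h s p → (a :* b) :* (h :* (s :* p)) := a :* (h :* (b :* (s :* p)))) refl _ _ _ _ _ ⟩
        ι R (n C i) * (egfCoeff g i * term i l) ∎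
      factor : ∀ i → ι R (n C i) * (egfCoeff g i * sumTo R n (term i))
                     ≈ sumTo R n (λ l → ι R (n C i) * (egfCoeff g i * term i l))
      factor i = trans (*-congˡ (*-distribˡ-sumTo n _ _)) (*-distribˡ-sumTo n _ _)

    egfCoeff-⊛-expS-rising : ∀ g n x →
      egfCoeff (_⊛_ R g (expS x)) n ≈ sumTo R n (λ m →
        sumFromTo R m n (λ l → ι R (S2 l m) * ι R (n C l) * egfCoeff (_⊛_ R g (expS (- ι R m))) (n ∸ l))
        * rising R x m)
    egfCoeff-⊛-expS-rising g n x = begin
      egfCoeff (_⊛_ R g (expS x)) n
        ≈⟨ egfCoeff-⊛-expS g x n ⟩
      sumTo R n (λ i → ι R (n C i) * (egfCoeff g i * pow R x (n ∸ i)))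
        ≈⟨ sumTo-cong n (λ i _ → *-congˡ (*-congˡ (trans (pow≈risingSum (n ∸ i) x) (sym (risingSum-extend i))))) ⟩
      sumTo R n (λ i → ι R (n C i) * (egfCoeff g i * sumTo R n (λ m → rising R x m * B i m)))
        ≈⟨ sumTo-cong n (λ i _ → distribute i) ⟩
      sumTo R n (λ i → sumTo R n (λ m → ι R (n C i) * (egfCoeff g i * B i m) * rising R x m))
        ≈⟨ sumTo-comm n n _ ⟩
      sumTo R n (λ m → sumTo R n (λ i → ι R (n C i) * (egfCoeff g i * B i m) * rising R x m))
        ≈⟨ sumTo-cong n (λ m m≤n → trans (sym (*-distribʳ-sumTo n _ _))
                                         (*-congʳ (sym (stirlingSum-⊛-expS g (- ι R m) m≤n)))) ⟩
      sumTo R n (λ m →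
        sumFromTo R m n (λ l → ι R (S2 l m) * ι R (n C l) * egfCoeff (_⊛_ R g (expS (- ι R m))) (n ∸ l))
        * rising R x m) ∎
      where
      B : ℕ → ℕ → Carrier
      B i m = binomStirling m (n ∸ i) (- ι R m)
      risingSum-extend : ∀ i → sumTo R n (λ m → rising R x m * B i m) ≈ sumTo R (n ∸ i) (λ m → rising R x m * B i m)
      risingSum-extend i = sumTo-extend _ (ℕₚ.m∸n≤m n i)
        (λ m n∸i<m → trans (*-congˡ (binomStirling-vanishes m (n ∸ i) _ n∸i<m)) (zeroʳ _))
      distribute : ∀ i → ι R (n C i) * (egfCoeff g i * sumTo R n (λ m → rising R x m * B i m))
                         ≈ sumTo R n (λ m → ι R (n C i) * (egfCoeff g i * B i m) * rising R x m)
      distribute i = trans (*-congˡ (*-distribˡ-sumTo n _ _)) (trans (*-distribˡ-sumTo n _ _)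
        (sumTo-cong n (λ m _ → solve 4 (λ c h r b → c :* (h :* (r :* b)) := c :* (h :* b) :* r) refl _ _ _ _)))

theorem7 : ∀ {c ℓ : Level} (R : CommutativeRing c ℓ) (F : CharZeroField R)
           (r : ℕ) → 1 ≤ r → (k : ℤ)
           (a : Fin r → CommutativeRing.Carrier R)
           (a≢0 : (j : Fin r) → ¬ (CommutativeRing._≈_ R (a j) (CommutativeRing.0# R)))
           (n : ℕ) (x : CommutativeRing.Carrier R) →
           let open CommutativeRing R
               open WithField R F
               S = Spoly r k a a≢0
           in S n x ≈ sumTo R n (λ m →
                sumFromTo R m n (λ l →
                  ι R (S2 l m) * ι R (n C l) * S (n ∸ l) (- ι R m))
                * rising R x m)
theorem7 R F r _ k a a≢0 n x =
  egfCoeff-⊛-expS-rising R F (_⊛_ R (prodS R r (λ j → tOverExpm1 (a j) (a≢0 j))) (liS k)) n x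
  where open WithField R F
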